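{- Let $k,l\ge1$. Every factor of $f_{\infty,\infty}$ of size $(k,l)$ can be extended, by appending one column on the right and one row at the bottom, to at least one factor of $f_{\infty,\infty}$ of size $(k+1,l+1)$; and the arrays obtained by all such extensions of all the $(k+1)(l+1)$ factors of size $(k,l)$ are exactly all the $(k+2)(l+2)$ distinct factors of $f_{\infty,\infty}$ of size $(k+1,l+1)$.
   Context: The $2D$ infinite Fibonacci word $f_{\infty,\infty}=[f(i,j)]_{i,j\ge1}$ over $\{a,b,c,d\}$ is the fixed point $\lim_{n}\mu^n(d)$ of the $2D$ morphism $d\mapsto\begin{smallmatrix}d&c\\ b&a\end{smallmatrix}$, $c\mapsto\begin{smallmatrix}d\\ b\end{smallmatrix}$, $b\mapsto\begin{smallmatrix}d&c\end{smallmatrix}$, $a\mapsto d$; equivalently, with $x=101101011\cdots$ the fixed point of $1\mapsto10,0\mapsto1$, $f(i,j)=d,c,b,a$ according as $(x_i,x_j)=(1,1),(1,0),(0,1),(0,0)$. A factor of size $(k,l)$ is a $k\times l$ block of $f_{\infty,\infty}$ occupying rows $i+1,\dots,i+k$ and columns $j+1,\dots,j+l$ for some $i,j\ge0$. -}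

module Defs where

open import Data.Nat using (ℕ; zero; suc; _+_)
open import Data.Bool using (Bool; true; false)
open import Data.List using (List; []; _∷_; length)
open import Data.Vec using (Vec; tabulate; init; map)
open import Data.Fin using (Fin; toℕ)
open import Data.Product using (Σ; _×_; _,_)
open import Data.List.Membership.Propositional using (_∈_)
open import Data.List.Relation.Unary.Unique.Propositional using (Unique)
open import Relation.Binary.PropositionalEquality using (_≡_)
open import Function.Bundles using (_⇔_)

data Letter : Set where
  a b c d : Letter

-- Fibonacci morphism 1 ↦ 10, 0 ↦ 1  (true = 1, false = 0)
σ : List Bool → List Bool
σ [] = []
σ (true ∷ w) = true ∷ false ∷ σ w
σ (false ∷ w) = true ∷ σ w

fibPrefix : ℕ → List Bool
fibPrefix zero = true ∷ []
fibPrefix (suc n) = σ (fibPrefix n)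

nth : List Bool → ℕ → Bool
nth [] _ = false
nth (x ∷ _) zero = x
nth (_ ∷ w) (suc n) = nth w n

-- x n = x_{n+1} of the paper (0-based indexing); σ^n(1) has length ≥ n+1
-- and each σ^n(1) is a prefix of the fixed point x = 101101011...
x : ℕ → Bool
x n = nth (fibPrefix n) n

letter : Bool → Bool → Letter
letter true  true  = d
letter true  false = c
letter false true  = b
letter false false = a

-- f n m = f(n+1, m+1) of the paper (0-based)
f : ℕ → ℕ → Letter
f n m = letter (x n) (x m)

Array : ℕ → ℕ → Set
Array k l = Vec (Vec Letter l) k

-- the block occupying rows i+1..i+k and columns j+1..j+l (1-based)
factorAt : ℕ → ℕ → (k l : ℕ) → Array k l
factorAt i j k l = tabulate λ r → tabulate λ s → f (i + toℕ r) (j + toℕ s)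

IsFactor : (k l : ℕ) → Array k l → Set
IsFactor k l A = Σ ℕ λ i → Σ ℕ λ j → factorAt i j k l ≡ A

topLeft : ∀ {k l} → Array (suc k) (suc l) → Array k l
topLeft B = map init (init B)

Extends : ∀ {k l} → Array (suc k) (suc l) → Array k l → Set
Extends B A = topLeft B ≡ A

FactorCount : (k l N : ℕ) → Set
FactorCount k l N =
  Σ (List (Array k l)) λ L →
    length L ≡ N × Unique L × ((A : Array k l) → IsFactor k l A ⇔ A ∈ L)

-- Every factor of f is determined by its first column and its first row, which are factors of x
-- at the same positions, and every pair of factors of x arises this way; so if x has n+1 factors of
-- length n, then f has (k+1)(l+1) factors of size (k,l). Extending or restricting a factor just
-- enlarges or shrinks the block at the same position.
-- For x = σ(x): every 0 is the second letter of a block 10, so two occurrences of a word, one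
-- preceded by 0 and one by 1, both start blocks of σ(x) and desubstitute to a shorter word with
-- the same property; by induction every left special factor of x is a prefix. Conversely σ maps
-- left special prefixes to longer ones, so every prefix is left special. Hence every factor of
-- length n has one left extension, except the prefix, which has two: x has n+1 factors of length n.
module Submission where

open import Defs
open import Data.Nat
  using (ℕ; zero; suc; _+_; _*_; _≤_; _<_; _≤′_; ≤′-refl; ≤′-step; z≤n; s≤s; z<s; _≤?_)
open import Data.Nat.Properties hiding (_≟_)
open import Data.Nat.Induction using (<-rec)
open import Algebra.Properties.CommutativeSemigroup +-commutativeSemigroup using (x∙yz≈y∙xz)
open import Data.Bool using (Bool; true; false; not)
import Data.Bool.Properties as Bool
open import Data.Fin using (toℕ)
open import Data.List using (List; []; _∷_; _++_; length; concatMap; cartesianProductWith)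
import Data.List as List
open import Data.List.Properties using (++-assoc; ++-identityʳ; length-++; length-map)
open import Data.List.Relation.Unary.All using (All; []; _∷_)
import Data.List.Relation.Unary.All as All
import Data.List.Relation.Unary.All.Properties as All
open import Data.List.Relation.Unary.Any using (Any; here; there)
import Data.List.Relation.Unary.Any as Any
import Data.List.Relation.Unary.Any.Properties as Any
open import Data.List.Relation.Unary.AllPairs using (AllPairs; []; _∷_)
import Data.List.Relation.Unary.AllPairs as AllPairs
import Data.List.Relation.Unary.AllPairs.Properties as AllPairs
open import Data.List.Relation.Unary.Unique.Propositional using (Unique)
import Data.List.Relation.Unary.Unique.Propositional.Properties as Unique
open import Data.List.Membership.Propositional using (_∈_)
open import Data.List.Membership.Propositional.Properties
  using (∈-map⁻; ∈-cartesianProductWith⁺; ∈-cartesianProductWith⁻)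
open import Data.Vec using (Vec; []; _∷_; head; init; tabulate)
import Data.Vec as Vec
open import Data.Vec.Properties using (≡-dec; ∷-injectiveˡ; ∷-injectiveʳ; map-∘; map-cong; tabulate-cong)
open import Data.Product using (Σ; ∃; _×_; _,_; proj₁; proj₂)
open import Data.Sum using (_⊎_; inj₁; inj₂)
open import Function using (_∘_)
open import Function.Bundles using (_⇔_; mk⇔; Equivalence)
open import Relation.Nullary using (Dec; yes; no; contradiction)
open import Relation.Binary.PropositionalEquality
open ≡-Reasoning

-- Binary sequences and their windows

Agree : (ℕ → Bool) → (ℕ → Bool) → ℕ → Set
Agree s t n = ∀ i → i < n → s i ≡ t i

suffix : (ℕ → Bool) → ℕ → ℕ → Bool
suffix s i t = s (i + t)

window : (ℕ → Bool) → ℕ → (n : ℕ) → Vec Bool n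
window s i zero = []
window s i (suc n) = s i ∷ window s (suc i) n

module _ {s t : ℕ → Bool} where

  Agree-sym : ∀ {n} → Agree s t n → Agree t s n
  Agree-sym ag i i<n = sym (ag i i<n)

  Agree-trans : ∀ {u n} → Agree s t n → Agree t u n → Agree s u n
  Agree-trans ag ag′ i i<n = trans (ag i i<n) (ag′ i i<n)

  Agree-≤ : ∀ {m n} → m ≤ n → Agree s t n → Agree s t m
  Agree-≤ m≤n ag i i<m = ag i (<-≤-trans i<m m≤n)

  Agree-snoc : ∀ {n} → Agree s t n → s n ≡ t n → Agree s t (suc n)
  Agree-snoc {n} ag eq i i<1+n with m<1+n⇒m<n∨m≡n i<1+n
  ... | inj₁ i<n = ag i i<n
  ... | inj₂ refl = eq

Agree-suffix⇒window : ∀ s i j n → Agree (suffix s i) (suffix s j) n → window s i n ≡ window s j n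
Agree-suffix⇒window s i j zero ag = refl
Agree-suffix⇒window s i j (suc n) ag = cong₂ _∷_ first rest
  where
  first : s i ≡ s j
  first = begin
    s i       ≡⟨ cong s (+-identityʳ i) ⟨
    s (i + 0) ≡⟨ ag 0 z<s ⟩
    s (j + 0) ≡⟨ cong s (+-identityʳ j) ⟩
    s j       ∎
  rest : window s (suc i) n ≡ window s (suc j) n
  rest = Agree-suffix⇒window s (suc i) (suc j) n λ t t<n → begin
    s (suc i + t) ≡⟨ cong s (+-suc i t) ⟨
    s (i + suc t) ≡⟨ ag (suc t) (s≤s t<n) ⟩
    s (j + suc t) ≡⟨ cong s (+-suc j t) ⟩
    s (suc j + t) ∎

Agree-suffix-head : ∀ s i j {n} → Agree (suffix s i) (suffix s j) (suc n) → s i ≡ s j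
Agree-suffix-head s i j {n} ag = ∷-injectiveˡ (Agree-suffix⇒window s i j (suc n) ag)

window⇒Agree-suffix : ∀ s i j n → window s i n ≡ window s j n → Agree (suffix s i) (suffix s j) n
window⇒Agree-suffix s i j (suc n) eq zero _ = begin
  s (i + 0) ≡⟨ cong s (+-identityʳ i) ⟩
  s i       ≡⟨ ∷-injectiveˡ eq ⟩
  s j       ≡⟨ cong s (+-identityʳ j) ⟨
  s (j + 0) ∎
window⇒Agree-suffix s i j (suc n) eq (suc t) (s≤s t<n) = begin
  s (i + suc t) ≡⟨ cong s (+-suc i t) ⟩
  s (suc i + t) ≡⟨ window⇒Agree-suffix s (suc i) (suc j) n (∷-injectiveʳ eq) t t<n ⟩
  s (suc j + t) ≡⟨ cong s (+-suc j t) ⟨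
  s (j + suc t) ∎

-- The Fibonacci word is the fixed point of σ

σ-++ : ∀ u v → σ (u ++ v) ≡ σ u ++ σ v
σ-++ [] v = refl
σ-++ (true ∷ u) v = cong (λ w → true ∷ false ∷ w) (σ-++ u v)
σ-++ (false ∷ u) v = cong (true ∷_) (σ-++ u v)

length-σ : ∀ w → length w ≤ length (σ w)
length-σ [] = z≤n
length-σ (true ∷ w) = m≤n⇒m≤1+n (s≤s (length-σ w))
length-σ (false ∷ w) = s≤s (length-σ w)

fibPrefix-head : ∀ m → ∃ λ w → fibPrefix m ≡ true ∷ w
fibPrefix-head zero = [] , refl
fibPrefix-head (suc m) with w , eq ← fibPrefix-head m = false ∷ σ w , cong σ eq

length-fibPrefix : ∀ m → m < length (fibPrefix m)
length-fibPrefix zero = s≤s z≤n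
length-fibPrefix (suc m) with fibPrefix m | fibPrefix-head m | length-fibPrefix m
... | .(true ∷ w) | w , refl | s≤s m<1+|w| = s≤s (s≤s (≤-trans m<1+|w| (length-σ w)))

fibPrefix-step : ∀ m → ∃ λ r → fibPrefix (suc m) ≡ fibPrefix m ++ r
fibPrefix-step zero = false ∷ [] , refl
fibPrefix-step (suc m) with r , eq ← fibPrefix-step m = σ r , trans (cong σ eq) (σ-++ (fibPrefix m) r)

fibPrefix-prefix : ∀ {m m′} → m ≤′ m′ → ∃ λ r → fibPrefix m′ ≡ fibPrefix m ++ r
fibPrefix-prefix {m} ≤′-refl = [] , sym (++-identityʳ (fibPrefix m))
fibPrefix-prefix {m} (≤′-step {m′} m≤′m′)
  with r , eq ← fibPrefix-prefix m≤′m′ | r′ , eq′ ← fibPrefix-step m′ = r ++ r′ , (begin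
    fibPrefix (suc m′)          ≡⟨ eq′ ⟩
    fibPrefix m′ ++ r′          ≡⟨ cong (_++ r′) eq ⟩
    (fibPrefix m ++ r) ++ r′    ≡⟨ ++-assoc (fibPrefix m) r r′ ⟩
    fibPrefix m ++ (r ++ r′)    ∎)

nth-++ˡ : ∀ u v {n} → n < length u → nth (u ++ v) n ≡ nth u n
nth-++ˡ (_ ∷ u) v {zero} _ = refl
nth-++ˡ (_ ∷ u) v {suc n} (s≤s n<|u|) = nth-++ˡ u v n<|u|

nth-fibPrefix : ∀ {m m′ n} → m ≤ m′ → n < length (fibPrefix m) →
  nth (fibPrefix m′) n ≡ nth (fibPrefix m) n
nth-fibPrefix {m} m≤m′ n<|w| with r , eq ← fibPrefix-prefix (≤⇒≤′ m≤m′) rewrite eq =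
  nth-++ˡ (fibPrefix m) r n<|w|

x-nth : ∀ {m n} → n < length (fibPrefix m) → x n ≡ nth (fibPrefix m) n
x-nth {m} {n} n<|w| with ≤-total n m
... | inj₁ n≤m = sym (nth-fibPrefix n≤m (length-fibPrefix n))
... | inj₂ m≤n = nth-fibPrefix m≤n n<|w|

σ-length : Bool → ℕ
σ-length true = 2
σ-length false = 1

1≤σ-length : ∀ bit → 1 ≤ σ-length bit
1≤σ-length true = s≤s z≤n
1≤σ-length false = s≤s z≤n

imageLength : (ℕ → Bool) → ℕ → ℕ
imageLength s zero = 0
imageLength s (suc m) = σ-length (s 0) + imageLength (suffix s 1) m

imageLength-cong : ∀ {s t} m → Agree s t m → imageLength s m ≡ imageLength t m
imageLength-cong zero _ = refl
imageLength-cong (suc m) ag =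
  cong₂ _+_ (cong σ-length (ag 0 z<s)) (imageLength-cong m λ i i<m → ag (suc i) (s≤s i<m))

imageLength-+ : ∀ s i m → imageLength s (i + m) ≡ imageLength s i + imageLength (suffix s i) m
imageLength-+ s zero m = refl
imageLength-+ s (suc i) m =
  trans (cong (σ-length (s 0) +_) (imageLength-+ (suffix s 1) i m))
        (sym (+-assoc (σ-length (s 0)) _ _))

imageLength-suc : ∀ s m → imageLength s (suc m) ≡ σ-length (s m) + imageLength s m
imageLength-suc s zero = refl
imageLength-suc s (suc m) = begin
  σ-length (s 0) + imageLength (suffix s 1) (suc m)
    ≡⟨ cong (σ-length (s 0) +_) (imageLength-suc (suffix s 1) m) ⟩
  σ-length (s 0) + (σ-length (s (suc m)) + imageLength (suffix s 1) m)
    ≡⟨ x∙yz≈y∙xz (σ-length (s 0)) (σ-length (s (suc m))) _ ⟩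
  σ-length (s (suc m)) + (σ-length (s 0) + imageLength (suffix s 1) m) ∎

m≤imageLength : ∀ s m → m ≤ imageLength s m
m≤imageLength s zero = z≤n
m≤imageLength s (suc m) = +-mono-≤ (1≤σ-length (s 0)) (m≤imageLength (suffix s 1) m)

imageLength-reaches : ∀ s n →
  ∃ λ m → m ≤ n × (∀ t → t < m → imageLength s t < n) × n ≤ imageLength s m
imageLength-reaches s zero = 0 , z≤n , (λ _ ()) , z≤n
imageLength-reaches s (suc n) with imageLength-reaches s n
... | m , m≤n , short , n≤|m| with suc n ≤? imageLength s m
...   | yes 1+n≤|m| = m , m≤n⇒m≤1+n m≤n , (λ t t<m → m<n⇒m<1+n (short t t<m)) , 1+n≤|m|
...   | no 1+n≰|m| = suc m , s≤s m≤n , short′ , reached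
  where
  |m|≡n : imageLength s m ≡ n
  |m|≡n = ≤-antisym (≤-pred (≰⇒> 1+n≰|m|)) n≤|m|
  short′ : ∀ t → t < suc m → imageLength s t < suc n
  short′ t t<1+m with m<1+n⇒m<n∨m≡n t<1+m
  ... | inj₁ t<m = m<n⇒m<1+n (short t t<m)
  ... | inj₂ refl = s≤s (≤-reflexive |m|≡n)
  reached : suc n ≤ imageLength s (suc m)
  reached = ≤-trans (≤-reflexive (cong suc (sym |m|≡n)))
    (≤-trans (+-monoˡ-≤ _ (1≤σ-length (s m))) (≤-reflexive (sym (imageLength-suc s m))))

-- σ(x i) occupies positions imageStart i, … of x.
imageStart : ℕ → ℕ
imageStart = imageLength x

σ-at-imageLength : ∀ w i → i < length w →
  nth (σ w) (imageLength (nth w) i) ≡ true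
  × (nth w i ≡ true → nth (σ w) (suc (imageLength (nth w) i)) ≡ false)
σ-at-imageLength (true ∷ w) zero _ = refl , λ _ → refl
σ-at-imageLength (false ∷ w) zero _ = refl , λ ()
σ-at-imageLength (true ∷ w) (suc i) (s≤s i<|w|) = σ-at-imageLength w i i<|w|
σ-at-imageLength (false ∷ w) (suc i) (s≤s i<|w|) = σ-at-imageLength w i i<|w|

x-σ-fibPrefix : ∀ M {n} → n ≤ M → x n ≡ nth (σ (fibPrefix M)) n
x-σ-fibPrefix M n≤M = x-nth {suc M} (≤-trans (s≤s n≤M) (<⇒≤ (length-fibPrefix (suc M))))

imageStart-nth : ∀ {M i} → i < length (fibPrefix M) → imageStart i ≡ imageLength (nth (fibPrefix M)) i
imageStart-nth {M} {i} i<|w| = imageLength-cong i λ t t<i → x-nth {M} (≤-trans (m<n⇒m<1+n t<i) i<|w|)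

i<length-fibPrefix : ∀ i → i < length (fibPrefix (suc (imageStart i)))
i<length-fibPrefix i = ≤-trans (s≤s (m≤n⇒m≤1+n (m≤imageLength x i))) (length-fibPrefix _)

x-imageStart : ∀ i → x (imageStart i) ≡ true
x-imageStart i = begin
  x (imageStart i)                  ≡⟨ x-σ-fibPrefix M (n≤1+n _) ⟩
  nth (σ w) (imageStart i)          ≡⟨ cong (nth (σ w)) (imageStart-nth {M} (i<length-fibPrefix i)) ⟩
  nth (σ w) (imageLength (nth w) i) ≡⟨ proj₁ (σ-at-imageLength w i (i<length-fibPrefix i)) ⟩
  true                              ∎
  where
  M : ℕ
  M = suc (imageStart i)
  w : List Bool
  w = fibPrefix M

x-suc-imageStart : ∀ i → x i ≡ true → x (suc (imageStart i)) ≡ false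
x-suc-imageStart i xi = begin
  x (suc (imageStart i))                  ≡⟨ x-σ-fibPrefix M ≤-refl ⟩
  nth (σ w) (suc (imageStart i))          ≡⟨ cong (nth (σ w) ∘ suc) (imageStart-nth {M} (i<length-fibPrefix i)) ⟩
  nth (σ w) (suc (imageLength (nth w) i)) ≡⟨ proj₂ (σ-at-imageLength w i (i<length-fibPrefix i)) wi ⟩
  false                                   ∎
  where
  M : ℕ
  M = suc (imageStart i)
  w : List Bool
  w = fibPrefix M
  wi : nth w i ≡ true
  wi = trans (sym (x-nth {M} (i<length-fibPrefix i))) xi

imageStart-suc : ∀ i {bit} → x i ≡ bit → imageStart (suc i) ≡ σ-length bit + imageStart i
imageStart-suc i xi≡bit = trans (imageLength-suc x i) (cong (λ bit → σ-length bit + imageStart i) xi≡bit)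

imageStart-+ : ∀ i m → Agree (suffix x i) x m → imageStart (i + m) ≡ imageStart i + imageStart m
imageStart-+ i m ag = trans (imageLength-+ x i m) (cong (imageStart i +_) (imageLength-cong m ag))

imageStart-mono-≤ : ∀ {i j} → i ≤ j → imageStart i ≤ imageStart j
imageStart-mono-≤ {i} i≤j with k , refl ← m≤n⇒∃[o]m+o≡n i≤j =
  subst (imageStart i ≤_) (sym (imageLength-+ x i k)) (m≤m+n (imageStart i) _)

imageStart-mono-< : ∀ {i j} → i < j → imageStart i < imageStart j
imageStart-mono-< {i} i<j =
  <-≤-trans (subst (imageStart i <_) (sym (imageStart-suc i refl)) (m<n+m _ (1≤σ-length (x i))))
            (imageStart-mono-≤ i<j)

imageStart-cancel-≤ : ∀ {i j} → imageStart i ≤ imageStart j → i ≤ j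
imageStart-cancel-≤ le = ≮⇒≥ λ j<i → <⇒≱ (imageStart-mono-< j<i) le

imageStart-cancel-< : ∀ {i j} → imageStart i < imageStart j → i < j
imageStart-cancel-< lt = ≰⇒> λ j≤i → <⇒≱ lt (imageStart-mono-≤ j≤i)

imageStart-cover : ∀ t → ∃ λ i → t ≡ imageStart i ⊎ (t ≡ suc (imageStart i) × x i ≡ true)
imageStart-cover zero = 0 , inj₁ refl
imageStart-cover (suc t) with imageStart-cover t
... | i , inj₂ (refl , xi) = suc i , inj₁ (sym (imageStart-suc i xi))
... | i , inj₁ refl with x i in xi
...   | true = i , inj₂ (refl , xi)
...   | false = suc i , inj₁ (sym (imageStart-suc i xi))

x-from-image : ∀ i → x i ≡ not (x (suc (imageStart i)))
x-from-image i with x i in xi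
... | true = cong not (sym (x-suc-imageStart i xi))
... | false = cong not (sym (trans (cong x (sym (imageStart-suc i xi))) (x-imageStart (suc i))))

x-from-image-+ : ∀ i m → x (i + m) ≡ not (x (imageStart i + suc (imageLength (suffix x i) m)))
x-from-image-+ i m = begin
  x (i + m)                                                 ≡⟨ x-from-image (i + m) ⟩
  not (x (suc (imageStart (i + m))))                        ≡⟨ cong (not ∘ x ∘ suc) (imageLength-+ x i m) ⟩
  not (x (suc (imageStart i + imageLength (suffix x i) m))) ≡⟨ cong (not ∘ x) (+-suc (imageStart i) _) ⟨
  not (x (imageStart i + suc (imageLength (suffix x i) m))) ∎

-- Since the next block of σ(x) starts with 1, the image of an occurrence of the prefix of
-- length m is an occurrence of the prefix of length imageStart m plus one.
Agree-image : ∀ i m → Agree (suffix x i) x m → Agree (suffix x (imageStart i)) x (suc (imageStart m))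
Agree-image i m ag t t≤|m| with imageStart-cover t
... | j , inj₁ refl = begin
    x (imageStart i + imageStart j) ≡⟨ cong x (imageStart-+ i j (Agree-≤ j≤m ag)) ⟨
    x (imageStart (i + j))          ≡⟨ x-imageStart (i + j) ⟩
    true                            ≡⟨ x-imageStart j ⟨
    x (imageStart j)                ∎
  where
  j≤m : j ≤ m
  j≤m = imageStart-cancel-≤ (≤-pred t≤|m|)
... | j , inj₂ (refl , xj) = begin
    x (imageStart i + suc (imageStart j)) ≡⟨ cong x (+-suc (imageStart i) (imageStart j)) ⟩
    x (suc (imageStart i + imageStart j)) ≡⟨ cong (x ∘ suc) (imageStart-+ i j (Agree-≤ (<⇒≤ j<m) ag)) ⟨
    x (suc (imageStart (i + j)))          ≡⟨ x-suc-imageStart (i + j) (trans (ag j j<m) xj) ⟩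
    false                                 ≡⟨ x-suc-imageStart j xj ⟨
    x (suc (imageStart j))                ∎
  where
  j<m : j < m
  j<m = imageStart-cancel-< (≤-pred t≤|m|)

-- Desubstitution: each letter of x is determined by the second letter of its image (x-from-image).
Agree-preimage : ∀ i j m {n} → Agree (suffix x (imageStart i)) (suffix x (imageStart j)) (suc n) →
  (∀ t → t < m → imageLength (suffix x i) t < n) → Agree (suffix x i) (suffix x j) m
Agree-preimage i j zero _ _ = λ _ ()
Agree-preimage i j (suc m) ag short = Agree-snoc previous (begin
  x (i + m)                                                 ≡⟨ x-from-image-+ i m ⟩
  not (x (imageStart i + suc (imageLength (suffix x i) m))) ≡⟨ cong not (ag _ (s≤s (short m (n<1+n m)))) ⟩
  not (x (imageStart j + suc (imageLength (suffix x i) m))) ≡⟨ cong (λ k → not (x (imageStart j + suc k)))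
                                                                    (imageLength-cong m previous) ⟩
  not (x (imageStart j + suc (imageLength (suffix x j) m))) ≡⟨ x-from-image-+ j m ⟨
  x (j + m)                                                 ∎)
  where
  previous : Agree (suffix x i) (suffix x j) m
  previous = Agree-preimage i j m ag (λ t t<m → short t (m<n⇒m<1+n t<m))

block-after-false : ∀ i → x i ≡ false → ∃ λ i₀ → x i₀ ≡ true × suc i ≡ imageStart (suc i₀)
block-after-false i xi with imageStart-cover i
... | i₀ , inj₁ refl = contradiction (trans (sym (x-imageStart i₀)) xi) λ ()
... | i₀ , inj₂ (refl , xi₀) = i₀ , xi₀ , sym (imageStart-suc i₀ xi₀)

block-after-true-true : ∀ j → x j ≡ true → x (suc j) ≡ true →
  ∃ λ j₀ → x j₀ ≡ false × suc j ≡ imageStart (suc j₀)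
block-after-true-true j xj x1+j with imageStart-cover j
... | j₀ , inj₂ (refl , xj₀) = contradiction (trans (sym (x-suc-imageStart j₀ xj₀)) xj) λ ()
... | j₀ , inj₁ refl with x j₀ in xj₀
...   | true = contradiction (trans (sym (x-suc-imageStart j₀ xj₀)) x1+j) λ ()
...   | false = j₀ , xj₀ , sym (imageStart-suc j₀ xj₀)

leftSpecial⇒prefix : ∀ n {i j} → x i ≡ false → x j ≡ true →
  Agree (suffix x (suc i)) (suffix x (suc j)) n → Agree (suffix x (suc i)) x n
leftSpecial⇒prefix = <-rec Goal step
  where
  Goal : ℕ → Set
  Goal n = ∀ {i j} → x i ≡ false → x j ≡ true →
    Agree (suffix x (suc i)) (suffix x (suc j)) n → Agree (suffix x (suc i)) x n
  step : ∀ n → (∀ {m} → m < n → Goal m) → Goal n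
  step zero _ _ _ _ = λ _ ()
  step (suc n) shorter {i} {j} xi xj ag with block-after-false i xi
  ... | i₀ , xi₀ , 1+i≡
    with block-after-true-true j xj
           (trans (sym (Agree-suffix-head x (suc i) (suc j) ag)) (trans (cong x 1+i≡) (x-imageStart (suc i₀))))
  ...   | j₀ , xj₀ , 1+j≡ with imageLength-reaches (suffix x (suc i₀)) n
  ...     | m , m≤n , short , n≤|m| =
    subst (λ p → Agree (suffix x p) x (suc n)) (sym 1+i≡)
      (Agree-≤ (s≤s n≤imageStart-m) (Agree-image (suc i₀) m agi₀0))
    where
    agImages : Agree (suffix x (imageStart (suc i₀))) (suffix x (imageStart (suc j₀))) (suc n)
    agImages = subst₂ (λ p q → Agree (suffix x p) (suffix x q) (suc n)) 1+i≡ 1+j≡ ag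
    agi₀j₀ : Agree (suffix x (suc i₀)) (suffix x (suc j₀)) m
    agi₀j₀ = Agree-preimage (suc i₀) (suc j₀) m agImages short
    agi₀0 : Agree (suffix x (suc i₀)) x m
    agi₀0 = Agree-trans agi₀j₀ (shorter (s≤s m≤n) {j₀} {i₀} xj₀ xi₀ (Agree-sym agi₀j₀))
    n≤imageStart-m : n ≤ imageStart m
    n≤imageStart-m = subst (n ≤_) (imageLength-cong m agi₀0) n≤|m|

LeftSpecialPrefix : ℕ → Set
LeftSpecialPrefix n = ∀ bit → ∃ λ i → x i ≡ bit × Agree (suffix x (suc i)) x n

leftSpecialPrefix-image : ∀ {m} → LeftSpecialPrefix m → LeftSpecialPrefix (suc (imageStart m))
leftSpecialPrefix-image {m} ls false with j , xj , ag ← ls true =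
  suc (imageStart j) , x-suc-imageStart j xj ,
  subst (λ p → Agree (suffix x p) x (suc (imageStart m))) (imageStart-suc j xj) (Agree-image (suc j) m ag)
leftSpecialPrefix-image {m} ls true with i , xi , ag ← ls false =
  imageStart i , x-imageStart i ,
  subst (λ p → Agree (suffix x p) x (suc (imageStart m))) (imageStart-suc i xi) (Agree-image (suc i) m ag)

leftSpecialPrefix : ∀ n → LeftSpecialPrefix n
leftSpecialPrefix zero false = 1 , refl , λ _ ()
leftSpecialPrefix zero true = 0 , refl , λ _ ()
leftSpecialPrefix (suc n) bit with i , xi , ag ← leftSpecialPrefix-image (leftSpecialPrefix n) bit =
  i , xi , Agree-≤ (s≤s (m≤imageLength x n)) ag

x-prefix-leftSpecial : ∀ n bit → ∃ λ i → x i ≡ bit × window x (suc i) n ≡ window x 0 n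
x-prefix-leftSpecial n bit with i , xi , ag ← leftSpecialPrefix n bit =
  i , xi , Agree-suffix⇒window x (suc i) 0 n ag

x-leftSpecial⇒prefix : ∀ n i j → x i ≢ x j →
  window x (suc i) n ≡ window x (suc j) n → window x (suc i) n ≡ window x 0 n
x-leftSpecial⇒prefix n i j xi≢xj eq with x i in xi | x j in xj
... | false | true =
  Agree-suffix⇒window x (suc i) 0 n
    (leftSpecial⇒prefix n {i} {j} xi xj (window⇒Agree-suffix x (suc i) (suc j) n eq))
... | true | false =
  trans eq (Agree-suffix⇒window x (suc j) 0 n
    (leftSpecial⇒prefix n {j} {i} xj xi (window⇒Agree-suffix x (suc j) (suc i) n (sym eq))))
... | false | false = contradiction refl xi≢xj
... | true | true = contradiction refl xi≢xj

-- Sequences whose left special factors are exactly their prefixes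

WindowCount : (ℕ → Bool) → (n N : ℕ) → Set
WindowCount s n N =
  Σ (List (Vec Bool n)) λ W →
    length W ≡ N × Unique W × ((w : Vec Bool n) → (∃ λ i → window s i n ≡ w) ⇔ w ∈ W)

module LeftSpecialPrefixes (s : ℕ → Bool)
  (prefix-leftSpecial : ∀ n bit → ∃ λ i → s i ≡ bit × window s (suc i) n ≡ window s 0 n)
  (leftSpecial⇒prefix : ∀ n i j → s i ≢ s j →
     window s (suc i) n ≡ window s (suc j) n → window s (suc i) n ≡ window s 0 n)
  where

  factor : (n : ℕ) → ℕ → Vec Bool n
  factor n i = window s i n

  Distinct : ℕ → ℕ → ℕ → Set
  Distinct n i j = factor n i ≢ factor n j

  _≟_ : ∀ {n} (u v : Vec Bool n) → Dec (u ≡ v)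
  _≟_ = ≡-dec Bool._≟_

  prefixExtension : ℕ → Bool → ℕ
  prefixExtension n bit = proj₁ (prefix-leftSpecial n bit)

  factor-prefixExtension : ∀ n bit → factor (suc n) (prefixExtension n bit) ≡ bit ∷ factor n 0
  factor-prefixExtension n bit =
    cong₂ _∷_ (proj₁ (proj₂ (prefix-leftSpecial n bit))) (proj₂ (proj₂ (prefix-leftSpecial n bit)))

  prefixExtensions : ℕ → List ℕ
  prefixExtensions n = prefixExtension n false ∷ prefixExtension n true ∷ []

  -- One occurrence of each left extension of factor n i; the prefix is the only factor with two.
  leftExtensions : ℕ → ℕ → List ℕ
  leftExtensions n zero = prefixExtensions n
  leftExtensions n (suc i) with factor n (suc i) ≟ factor n 0
  ... | yes _ = prefixExtensions n
  ... | no _ = i ∷ []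

  leftExtensions-tail : ∀ n i → All (λ p → factor n (suc p) ≡ factor n i) (leftExtensions n i)
  leftExtensions-tail n zero = prefixTails
    where
    prefixTails : All (λ p → factor n (suc p) ≡ factor n 0) (prefixExtensions n)
    prefixTails =
      ∷-injectiveʳ (factor-prefixExtension n false) ∷ ∷-injectiveʳ (factor-prefixExtension n true) ∷ []
  leftExtensions-tail n (suc i) with factor n (suc i) ≟ factor n 0
  ... | yes i≈0 = All.map (λ p≈0 → trans p≈0 (sym i≈0)) (leftExtensions-tail n zero)
  ... | no _ = refl ∷ []

  prefixExtensions-complete : ∀ n p → factor n (suc p) ≡ factor n 0 →
    Any (λ q → factor (suc n) q ≡ factor (suc n) p) (prefixExtensions n)
  prefixExtensions-complete n p p≈0 with s p
  ... | false = here (trans (factor-prefixExtension n false) (cong (_ ∷_) (sym p≈0)))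
  ... | true = there (here (trans (factor-prefixExtension n true) (cong (_ ∷_) (sym p≈0))))

  leftExtensions-complete : ∀ n i p → factor n (suc p) ≡ factor n i →
    Any (λ q → factor (suc n) q ≡ factor (suc n) p) (leftExtensions n i)
  leftExtensions-complete n zero p p≈i = prefixExtensions-complete n p p≈i
  leftExtensions-complete n (suc i) p p≈i with factor n (suc i) ≟ factor n 0
  ... | yes i≈0 = prefixExtensions-complete n p (trans p≈i i≈0)
  ... | no i≉0 with s i Bool.≟ s p
  ...   | yes si≡sp = here (cong₂ _∷_ si≡sp (sym p≈i))
  ...   | no si≢sp = contradiction (trans (sym p≈i) (leftSpecial⇒prefix n p i (si≢sp ∘ sym) p≈i)) i≉0

  leftExtensions-distinct : ∀ n i → AllPairs (Distinct (suc n)) (leftExtensions n i)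
  leftExtensions-distinct n zero = (false≉true ∷ []) ∷ [] ∷ []
    where
    false≉true : Distinct (suc n) (prefixExtension n false) (prefixExtension n true)
    false≉true eq
      with () ← ∷-injectiveˡ (trans (sym (factor-prefixExtension n false)) (trans eq (factor-prefixExtension n true)))
  leftExtensions-distinct n (suc i) with factor n (suc i) ≟ factor n 0
  ... | yes _ = leftExtensions-distinct n zero
  ... | no _ = [] ∷ []

  length-leftExtensions-prefix : ∀ n i → factor n i ≡ factor n 0 → length (leftExtensions n i) ≡ 2
  length-leftExtensions-prefix n zero _ = refl
  length-leftExtensions-prefix n (suc i) i≈0 with factor n (suc i) ≟ factor n 0
  ... | yes _ = refl
  ... | no i≉0 = contradiction i≈0 i≉0

  length-leftExtensions-other : ∀ n i → factor n i ≢ factor n 0 → length (leftExtensions n i) ≡ 1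
  length-leftExtensions-other n zero i≉0 = contradiction refl i≉0
  length-leftExtensions-other n (suc i) i≉0 with factor n (suc i) ≟ factor n 0
  ... | yes i≈0 = contradiction i≈0 i≉0
  ... | no _ = refl

  positions : ℕ → List ℕ
  positions zero = 0 ∷ []
  positions (suc n) = concatMap (leftExtensions n) (positions n)

  positions-complete : ∀ n p → Any (λ q → factor n q ≡ factor n p) (positions n)
  positions-complete zero p = here refl
  positions-complete (suc n) p = Any.concat⁺ (Any.map⁺
    (Any.map (λ {q} q≈1+p → leftExtensions-complete n q p (sym q≈1+p)) (positions-complete n (suc p))))

  extensions-apart : ∀ n {i j} → Distinct n i j →
    All (λ p → All (Distinct (suc n) p) (leftExtensions n j)) (leftExtensions n i)
  extensions-apart n {i} {j} i≉j = All.map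
    (λ p≈i → All.map (λ q≈j p≈q → i≉j (trans (sym p≈i) (trans (∷-injectiveʳ p≈q) q≈j)))
                     (leftExtensions-tail n j))
    (leftExtensions-tail n i)

  positions-distinct : ∀ n → AllPairs (Distinct n) (positions n)
  positions-distinct zero = [] ∷ []
  positions-distinct (suc n) = AllPairs.concat⁺
    (All.map⁺ (All.universal (leftExtensions-distinct n) (positions n)))
    (AllPairs.map⁺ (AllPairs.map (extensions-apart n) (positions-distinct n)))

  length-concatMap-other : ∀ n ls → All (λ q → factor n q ≢ factor n 0) ls →
    length (concatMap (leftExtensions n) ls) ≡ length ls
  length-concatMap-other n [] [] = refl
  length-concatMap-other n (q ∷ ls) (q≉0 ∷ ls≉0) = trans (length-++ (leftExtensions n q))
    (cong₂ _+_ (length-leftExtensions-other n q q≉0) (length-concatMap-other n ls ls≉0))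

  others-not-prefix : ∀ {n q ls} → factor n q ≡ factor n 0 → All (Distinct n q) ls →
    All (λ q′ → factor n q′ ≢ factor n 0) ls
  others-not-prefix q≈0 = All.map (λ q≉q′ q′≈0 → q≉q′ (trans q≈0 (sym q′≈0)))

  length-concatMap-prefix : ∀ n ls → AllPairs (Distinct n) ls → Any (λ q → factor n q ≡ factor n 0) ls →
    length (concatMap (leftExtensions n) ls) ≡ suc (length ls)
  length-concatMap-prefix n (q ∷ ls) (q≉ls ∷ _) (here q≈0) = trans (length-++ (leftExtensions n q))
    (cong₂ _+_ (length-leftExtensions-prefix n q q≈0)
               (length-concatMap-other n ls (others-not-prefix q≈0 q≉ls)))
  length-concatMap-prefix n (q ∷ ls) (q≉ls ∷ ls!) (there some) = trans (length-++ (leftExtensions n q))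
    (cong₂ _+_ (length-leftExtensions-other n q λ q≈0 → All.All¬⇒¬Any (others-not-prefix q≈0 q≉ls) some)
               (length-concatMap-prefix n ls ls! some))

  length-positions : ∀ n → length (positions n) ≡ suc n
  length-positions zero = refl
  length-positions (suc n) = trans
    (length-concatMap-prefix n (positions n) (positions-distinct n) (positions-complete n 0))
    (cong suc (length-positions n))

  windowCount : ∀ n → WindowCount s n (suc n)
  windowCount n =
    List.map (factor n) (positions n) ,
    trans (length-map (factor n) (positions n)) (length-positions n) ,
    AllPairs.map⁺ (positions-distinct n) ,
    λ w → mk⇔ (λ { (i , refl) → Any.map⁺ (Any.map sym (positions-complete n i)) })
              (λ w∈ → let q , _ , w≡ = ∈-map⁻ (factor n) w∈ in q , sym w≡)

open LeftSpecialPrefixes x x-prefix-leftSpecial x-leftSpecial⇒prefix renaming (windowCount to x-windowCount)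

-- Factors of the 2D word as pairs of factors of x

arrayOf : ∀ {k l} → Vec Bool k → Vec Bool l → Array k l
arrayOf u v = Vec.map (λ p → Vec.map (letter p) v) u

map-window : ∀ {A : Set} (g : Bool → A) s i n →
  Vec.map g (window s i n) ≡ tabulate (λ r → g (s (i + toℕ r)))
map-window g s i zero = refl
map-window g s i (suc n) = cong₂ _∷_ (cong (g ∘ s) (sym (+-identityʳ i)))
  (trans (map-window g s (suc i) n) (tabulate-cong λ r → cong (g ∘ s) (sym (+-suc i (toℕ r)))))

factorAt≡arrayOf : ∀ i j k l → factorAt i j k l ≡ arrayOf (window x i k) (window x j l)
factorAt≡arrayOf i j k l = sym (trans (map-window _ x i k) (tabulate-cong λ r → map-window _ x j l))

rowBit colBit : Letter → Bool
rowBit a = false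
rowBit b = false
rowBit c = true
rowBit d = true
colBit a = false
colBit b = true
colBit c = false
colBit d = true

rowBit-letter : ∀ p q → rowBit (letter p q) ≡ p
rowBit-letter true true = refl
rowBit-letter true false = refl
rowBit-letter false true = refl
rowBit-letter false false = refl

colBit-letter : ∀ p q → colBit (letter p q) ≡ q
colBit-letter true true = refl
colBit-letter true false = refl
colBit-letter false true = refl
colBit-letter false false = refl

rows-arrayOf : ∀ {k l} (u : Vec Bool k) (v : Vec Bool (suc l)) → Vec.map (rowBit ∘ head) (arrayOf u v) ≡ u
rows-arrayOf [] _ = refl
rows-arrayOf (p ∷ u) (q ∷ v) = cong₂ _∷_ (rowBit-letter p q) (rows-arrayOf u (q ∷ v))

columns-arrayOf : ∀ {k l} (u : Vec Bool (suc k)) (v : Vec Bool l) → Vec.map colBit (head (arrayOf u v)) ≡ v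
columns-arrayOf (p ∷ _) [] = refl
columns-arrayOf (p ∷ u) (q ∷ v) = cong₂ _∷_ (colBit-letter p q) (columns-arrayOf (p ∷ u) v)

arrayOf-injective : ∀ {k l} {u u′ : Vec Bool (suc k)} {v v′ : Vec Bool (suc l)} →
  arrayOf u v ≡ arrayOf u′ v′ → u ≡ u′ × v ≡ v′
arrayOf-injective {u = u} {u′} {v} {v′} eq =
  trans (sym (rows-arrayOf u v)) (trans (cong (Vec.map (rowBit ∘ head)) eq) (rows-arrayOf u′ v′)) ,
  trans (sym (columns-arrayOf u v)) (trans (cong (Vec.map colBit ∘ head) eq) (columns-arrayOf u′ v′))

length-cartesianProductWith : ∀ {A B C : Set} (g : A → B → C) xs ys →
  length (cartesianProductWith g xs ys) ≡ length xs * length ys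
length-cartesianProductWith g [] ys = refl
length-cartesianProductWith g (p ∷ xs) ys = trans (length-++ (List.map (g p) ys))
  (cong₂ _+_ (length-map (g p) ys) (length-cartesianProductWith g xs ys))

factorCount-product : ∀ {k l p q} → WindowCount x (suc k) p → WindowCount x (suc l) q →
  FactorCount (suc k) (suc l) (p * q)
factorCount-product {k} {l} (U , |U| , U! , U⇔) (V , |V| , V! , V⇔) =
  cartesianProductWith arrayOf U V ,
  trans (length-cartesianProductWith arrayOf U V) (cong₂ _*_ |U| |V|) ,
  Unique.cartesianProductWith⁺ arrayOf arrayOf-injective U! V! ,
  λ A → mk⇔ occurs⇒∈ ∈⇒occurs
  where
  occurs⇒∈ : ∀ {A} → IsFactor (suc k) (suc l) A → A ∈ cartesianProductWith arrayOf U V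
  occurs⇒∈ (i , j , refl) =
    subst (_∈ cartesianProductWith arrayOf U V) (sym (factorAt≡arrayOf i j (suc k) (suc l)))
    (∈-cartesianProductWith⁺ arrayOf (Equivalence.to (U⇔ _) (i , refl)) (Equivalence.to (V⇔ _) (j , refl)))
  ∈⇒occurs : ∀ {A} → A ∈ cartesianProductWith arrayOf U V → IsFactor (suc k) (suc l) A
  ∈⇒occurs A∈ with u , v , u∈ , v∈ , refl ← ∈-cartesianProductWith⁻ arrayOf U V A∈
    with i , refl ← Equivalence.from (U⇔ u) u∈ | j , refl ← Equivalence.from (V⇔ v) v∈ =
    i , j , factorAt≡arrayOf i j (suc k) (suc l)

init-window : ∀ s i n → init (window s i (suc n)) ≡ window s i n
init-window s i zero = refl
init-window s i (suc n) = cong (s i ∷_) (init-window s (suc i) n)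

init-map : ∀ {A B : Set} {n} (g : A → B) (u : Vec A (suc n)) → init (Vec.map g u) ≡ Vec.map g (init u)
init-map g (p ∷ []) = refl
init-map g (p ∷ q ∷ u) = cong (g p ∷_) (init-map g (q ∷ u))

topLeft-arrayOf : ∀ {k l} (u : Vec Bool (suc k)) (v : Vec Bool (suc l)) →
  topLeft (arrayOf u v) ≡ arrayOf (init u) (init v)
topLeft-arrayOf {k} {l} u v = begin
  Vec.map init (init (Vec.map row u))   ≡⟨ cong (Vec.map init) (init-map row u) ⟩
  Vec.map init (Vec.map row (init u))   ≡⟨ map-∘ init row (init u) ⟨
  Vec.map (init ∘ row) (init u)         ≡⟨ map-cong (λ p → init-map (letter p) v) (init u) ⟩
  arrayOf (init u) (init v)             ∎
  where
  row : Bool → Vec Letter (suc l)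
  row p = Vec.map (letter p) v

topLeft-factorAt : ∀ i j k l → topLeft (factorAt i j (suc k) (suc l)) ≡ factorAt i j k l
topLeft-factorAt i j k l = begin
  topLeft (factorAt i j (suc k) (suc l))
    ≡⟨ cong topLeft (factorAt≡arrayOf i j (suc k) (suc l)) ⟩
  topLeft (arrayOf (window x i (suc k)) (window x j (suc l)))
    ≡⟨ topLeft-arrayOf (window x i (suc k)) (window x j (suc l)) ⟩
  arrayOf (init (window x i (suc k))) (init (window x j (suc l)))
    ≡⟨ cong₂ arrayOf (init-window x i k) (init-window x j l) ⟩
  arrayOf (window x i k) (window x j l)
    ≡⟨ factorAt≡arrayOf i j k l ⟨
  factorAt i j k l ∎

factorCount : ∀ k l → FactorCount (suc k) (suc l) (suc (suc k) * suc (suc l))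
factorCount k l = factorCount-product (x-windowCount (suc k)) (x-windowCount (suc l))

mainTheorem4 : (k l : ℕ) → 1 ≤ k → 1 ≤ l →
    FactorCount k l (suc k * suc l)
    × ((A : Array k l) → IsFactor k l A →
         Σ (Array (suc k) (suc l)) λ B → IsFactor (suc k) (suc l) B × Extends B A)
    × ((B : Array (suc k) (suc l)) → IsFactor (suc k) (suc l) B →
         Σ (Array k l) λ A → IsFactor k l A × Extends B A)
    × FactorCount (suc k) (suc l) (suc (suc k) * suc (suc l))
mainTheorem4 (suc k) (suc l) _ _ =
  factorCount k l ,
  (λ { _ (i , j , refl) → factorAt i j _ _ , (i , j , refl) , topLeft-factorAt i j _ _ }) ,
  (λ { _ (i , j , refl) → factorAt i j _ _ , (i , j , refl) , topLeft-factorAt i j _ _ }) ,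
  factorCount (suc k) (suc l)
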